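{- Let $A$ be an $\ell\times k$ irredundant integer matrix of full rank $\ell$ which satisfies $(*)$. Then for every $W\subseteq[k]$ (with $\overline W=[k]\setminus W$): (i) if $|W|=1$ then $\mathrm{rank}(A_{\overline W})=\ell$; (ii) if $|W|\ge2$ then $\ell-\mathrm{rank}(A_{\overline W})+2\le|W|$; (iii) if $|W|\ge2$ then $-|W|-\mathrm{rank}(A_{\overline W})\le-\ell-1-\frac{|W|-1}{m(A)}$. Furthermore, (iv) $k\ge\ell+2$, and (v) $m(A)>1$.
   Context: $A$ is irredundant if $Ax=0$ has a solution $x\in\mathbb N^k$ with pairwise distinct coordinates. $A$ satisfies $(*)$ if under Gaussian elimination $A$ has no row consisting of precisely two nonzero rational entries (i.e. the row space of $A$ contains no vector with exactly two nonzero entries). Columns are indexed by $[k]$; $A_{\overline W}$ is the submatrix formed by the columns in $\overline W$, with $\mathrm{rank}(A_\emptyset)=0$. $m(A)=\max\frac{|W|-1}{|W|-1+\mathrm{rank}(A_{\overline W})-\mathrm{rank}(A)}$ over partitions $W\,\dot\cup\,\overline W=[k]$ with $|W|\ge2$. -}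

module Defs where

open import Data.Nat as ℕ using (ℕ; zero; suc)
open import Data.Integer as ℤ using (ℤ)
open import Data.Rational as ℚ using (ℚ; 0ℚ; _÷_; _/_)
open import Data.Rational.Properties using () renaming (_≟_ to _≟ℚ_)
open import Data.Fin using (Fin; zero; suc)
open import Data.Fin.Subset using (Subset; _∈_; ∁; ⊤; ∣_∣)
open import Data.Product using (Σ; Σ-syntax; ∃; ∃-syntax; _×_; _,_)
open import Function.Definitions using (Injective)
open import Relation.Binary.PropositionalEquality using (_≡_; _≢_)
open import Relation.Nullary using (¬_; yes; no)
open import Data.Empty using (⊥)

Matrix : ℕ → ℕ → Set
Matrix l k = Fin l → Fin k → ℤ

sumℚ : ∀ {n} → (Fin n → ℚ) → ℚ
sumℚ {zero}  f = 0ℚ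
sumℚ {suc n} f = f zero ℚ.+ sumℚ (λ i → f (suc i))

sumℤ : ∀ {n} → (Fin n → ℤ) → ℤ
sumℤ {zero}  f = ℤ.+ 0
sumℤ {suc n} f = f zero ℤ.+ sumℤ (λ i → f (suc i))

ι : ℤ → ℚ
ι z = z / 1

-- Division of rationals, with the (irrelevant here) convention p / 0 = 0.
_÷₀_ : ℚ → ℚ → ℚ
p ÷₀ q with q ≟ℚ 0ℚ
... | yes _  = 0ℚ
... | no q≢0 = _÷_ p q {{ℚ.≢-nonZero q≢0}}

ColsIndependent : ∀ {l k r} → Matrix l k → (Fin r → Fin k) → Set
ColsIndependent {l} {k} {r} A f =
  (c : Fin r → ℚ) →
  (∀ (i : Fin l) → sumℚ (λ j → c j ℚ.* ι (A i (f j))) ≡ 0ℚ) →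
  ∀ j → c j ≡ 0ℚ

IsColRank : ∀ {l k} → Matrix l k → Subset k → ℕ → Set
IsColRank {l} {k} A S r =
  (Σ[ f ∈ (Fin r → Fin k) ] Injective _≡_ _≡_ f × (∀ j → f j ∈ S) × ColsIndependent A f)
  × (∀ (g : Fin (suc r) → Fin k) → Injective _≡_ _≡_ g → (∀ j → g j ∈ S) →
       ¬ ColsIndependent A g)

Irredundant : ∀ {l k} → Matrix l k → Set
Irredundant {l} {k} A =
  Σ[ x ∈ (Fin k → ℕ) ] (∀ j → 1 ℕ.≤ x j) × Injective _≡_ _≡_ x ×
    (∀ i → sumℤ (λ j → A i j ℤ.* ℤ.+ (x j)) ≡ ℤ.+ 0)

ExactlyTwoNonzero : ∀ {k} → (Fin k → ℚ) → Set
ExactlyTwoNonzero {k} v =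
  Σ[ a ∈ Fin k ] Σ[ b ∈ Fin k ] a ≢ b × v a ≢ 0ℚ × v b ≢ 0ℚ ×
    (∀ t → t ≢ a → t ≢ b → v t ≡ 0ℚ)

-- Condition (*): the row space of A (over ℚ) contains no vector with
-- exactly two nonzero entries.
Star : ∀ {l k} → Matrix l k → Set
Star {l} {k} A =
  ∀ (y : Fin l → ℚ) → ¬ ExactlyTwoNonzero (λ j → sumℚ (λ i → y i ℚ.* ι (A i j)))

density : ℕ → ℕ → ℕ → ℚ
density w rW rA =
  ι (ℤ.+ w ℤ.- ℤ.+ 1) ÷₀ ι (ℤ.+ w ℤ.- ℤ.+ 1 ℤ.+ ℤ.+ rW ℤ.- ℤ.+ rA)

IsM : ∀ {l k} → Matrix l k → ℚ → Set
IsM {l} {k} A q =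
  (Σ[ W ∈ Subset k ] 2 ℕ.≤ ∣ W ∣ × Σ[ rW ∈ ℕ ] Σ[ rA ∈ ℕ ]
     IsColRank A (∁ W) rW × IsColRank A ⊤ rA × q ≡ density ∣ W ∣ rW rA)
  × (∀ (W : Subset k) → 2 ℕ.≤ ∣ W ∣ → ∀ rW rA →
       IsColRank A (∁ W) rW → IsColRank A ⊤ rA → density ∣ W ∣ rW rA ℚ.≤ q)

-- Everything rests on one fact: when A has full rank ℓ, every nonzero vector yA of its row
-- space has at least three nonzero entries.  It cannot vanish (y ≠ 0 would be orthogonal to ℓ
-- independent columns), it cannot have exactly one nonzero entry w (for a positive solution x
-- of Ax = 0, 0 = y·Ax = (yA)_w x_w), and exactly two are excluded by (*).
-- For (ii): if |W| + rank(A_W̄) ≤ ℓ + 1, some y ≠ 0 is orthogonal to a basis of the columns in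
-- W̄ and to all but two columns of W, fewer than ℓ vectors in all.  By maximality of the basis,
-- y is orthogonal to every column in W̄, so yA is supported on two entries.  (i) is an exchange
-- argument resting on the same fact, (iv) is (ii) for W = [k], and (iii), (v) are arithmetic:
-- (ii) makes the denominators of the densities positive, and W = [k] has density
-- (k - 1)/(k - 1 - ℓ) > 1.

module Submission where

open import Defs
open import Data.Nat as ℕ using (ℕ; zero; suc; z≤n; s≤s)
import Data.Nat.Properties as ℕP
open import Data.Integer as ℤ using (ℤ)
import Data.Integer.Properties as ℤP
import Data.Integer.Solver as ZSolver
import Data.Nat.Coprimality as Coprime
open import Data.Rational as ℚ using (ℚ; 0ℚ; 1ℚ; _+_; _*_; -_; _-_; 1/_)
import Data.Rational.Properties as ℚP
open import Data.Rational.Solver using (module +-*-Solver)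
open import Data.Fin using (Fin; zero; suc; punchIn; punchOut; _↑ˡ_; _↑ʳ_)
open import Data.Fin.Subset using (Subset; _∈_; ∁; ⊤; ∣_∣; inside; outside)
open import Data.Fin.Subset.Properties using (_∈?_; x∉p⇒x∈∁p; x∈∁p⇒x∉p; ∈⊤; ∣⊤∣≡n)
import Data.Fin.Properties as FinP
open import Data.Vec.Functional using (Vector; _∷_; _++_; tail; removeAt; insertAt)
open import Data.Vec using ([]; there) renaming (_∷_ to _∷ᵥ_)
open import Data.Vec.Functional.Properties using (insertAt-lookup; insertAt-punchIn; lookup-++ˡ; lookup-++ʳ)
open import Data.Product using (Σ-syntax; ∃-syntax; _,_; _×_; proj₁; proj₂)
open import Data.Empty using (⊥; ⊥-elim)
open import Data.Sum using (_⊎_; inj₁; inj₂)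
open import Function.Definitions using (Injective)
open import Function using (_∘_)
open import Relation.Nullary using (¬_; yes; no)
open import Relation.Nullary.Decidable using (_⊎-dec_)
open import Relation.Binary.PropositionalEquality

open ≡-Reasoning

private
  variable
    l k m n r : ℕ

sumℚ-cong : {f g : Vector ℚ n} → f ≗ g → sumℚ f ≡ sumℚ g
sumℚ-cong {zero}  f≗g = refl
sumℚ-cong {suc n} f≗g = cong₂ _+_ (f≗g zero) (sumℚ-cong (f≗g ∘ suc))

sumℚ-zero : {f : Vector ℚ n} → (∀ i → f i ≡ 0ℚ) → sumℚ f ≡ 0ℚ
sumℚ-zero {zero}  f≡0 = refl
sumℚ-zero {suc n} f≡0 = trans (cong₂ _+_ (f≡0 zero) (sumℚ-zero (f≡0 ∘ suc))) (ℚP.+-identityʳ 0ℚ)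

sumℚ-distrib-+ : (f g : Vector ℚ n) → sumℚ (λ i → f i + g i) ≡ sumℚ f + sumℚ g
sumℚ-distrib-+ {zero}  f g = sym (ℚP.+-identityʳ 0ℚ)
sumℚ-distrib-+ {suc n} f g = trans (cong (f zero + g zero +_) (sumℚ-distrib-+ (f ∘ suc) (g ∘ suc)))
  (solve 4 (λ a b c d → a :+ b :+ (c :+ d) := a :+ c :+ (b :+ d)) refl (f zero) (g zero) _ _)
  where open +-*-Solver

*-distribˡ-sumℚ : ∀ c (f : Vector ℚ n) → c * sumℚ f ≡ sumℚ (λ i → c * f i)
*-distribˡ-sumℚ {zero}  c f = ℚP.*-zeroʳ c
*-distribˡ-sumℚ {suc n} c f = trans (ℚP.*-distribˡ-+ c _ _) (cong (c * f zero +_) (*-distribˡ-sumℚ c (f ∘ suc)))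

sumℚ-comm : (F : Fin m → Fin n → ℚ) →
  sumℚ (λ i → sumℚ (λ j → F i j)) ≡ sumℚ (λ j → sumℚ (λ i → F i j))
sumℚ-comm {zero}  F = sym (sumℚ-zero {f = λ j → sumℚ (λ i → F i j)} (λ _ → refl))
sumℚ-comm {suc m} F = trans (cong (sumℚ (F zero) +_) (sumℚ-comm (F ∘ suc)))
  (sym (sumℚ-distrib-+ (F zero) (λ j → sumℚ (λ i → F (suc i) j))))

sumℚ-remove : (i : Fin (suc n)) (f : Vector ℚ (suc n)) → sumℚ f ≡ f i + sumℚ (removeAt f i)
sumℚ-remove zero    f = refl
sumℚ-remove {suc n} (suc i) f = trans (cong (f zero +_) (sumℚ-remove i (f ∘ suc)))
  (solve 3 (λ a b c → a :+ (b :+ c) := b :+ (a :+ c)) refl (f zero) (f (suc i)) _)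
  where open +-*-Solver

sumℚ-single : (i : Fin n) (f : Vector ℚ n) → (∀ j → j ≢ i → f j ≡ 0ℚ) → sumℚ f ≡ f i
sumℚ-single {suc n} i f f≡0 = trans (sumℚ-remove i f)
  (trans (cong (f i +_) (sumℚ-zero (λ q → f≡0 _ (FinP.punchInᵢ≢i i q)))) (ℚP.+-identityʳ (f i)))

dot : Vector ℚ n → Vector ℚ n → ℚ
dot u v = sumℚ (λ i → u i * v i)

dot-zeroʳ : (u : Vector ℚ n) {v : Vector ℚ n} → (∀ i → v i ≡ 0ℚ) → dot u v ≡ 0ℚ
dot-zeroʳ u v≡0 = sumℚ-zero (λ i → trans (cong (u i *_) (v≡0 i)) (ℚP.*-zeroʳ (u i)))

dot-linear : (y u w : Vector ℚ n) (k : ℚ) →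
  dot y (λ j → u j - k * w j) ≡ dot y u - k * dot y w
dot-linear y u w k = begin
  dot y (λ j → u j - k * w j)
    ≡⟨ sumℚ-cong (λ j → solve 4 (λ y u w k → y :* (u :- k :* w) := y :* u :+ (:- k) :* (y :* w))
                                refl (y j) (u j) (w j) k) ⟩
  sumℚ (λ j → y j * u j + (- k) * (y j * w j))
    ≡⟨ sumℚ-distrib-+ (λ j → y j * u j) (λ j → (- k) * (y j * w j)) ⟩
  dot y u + sumℚ (λ j → (- k) * (y j * w j))
    ≡⟨ cong (dot y u +_) (sym (*-distribˡ-sumℚ (- k) (λ j → y j * w j))) ⟩
  dot y u + (- k) * dot y w
    ≡⟨ solve 3 (λ a k b → a :+ (:- k) :* b := a :- k :* b) refl (dot y u) k (dot y w) ⟩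
  dot y u - k * dot y w ∎
  where open +-*-Solver

linComb : Vector ℚ r → (Fin r → Vector ℚ n) → Vector ℚ n
linComb c vs i = dot c (λ t → vs t i)

dot-linComb : (y : Vector ℚ n) (c : Vector ℚ r) (vs : Fin r → Vector ℚ n) →
  dot y (linComb c vs) ≡ dot c (λ t → dot y (vs t))
dot-linComb y c vs = begin
  sumℚ (λ i → y i * sumℚ (λ t → c t * vs t i))
    ≡⟨ sumℚ-cong (λ i → *-distribˡ-sumℚ (y i) (λ t → c t * vs t i)) ⟩
  sumℚ (λ i → sumℚ (λ t → y i * (c t * vs t i)))
    ≡⟨ sumℚ-comm (λ i t → y i * (c t * vs t i)) ⟩
  sumℚ (λ t → sumℚ (λ i → y i * (c t * vs t i)))
    ≡⟨ sumℚ-cong (λ t → trans (sumℚ-cong (λ i → swap (y i) (c t) (vs t i)))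
                               (sym (*-distribˡ-sumℚ (c t) (λ i → y i * vs t i)))) ⟩
  sumℚ (λ t → c t * dot y (vs t)) ∎
  where
  open +-*-Solver
  swap : ∀ a b d → a * (b * d) ≡ b * (a * d)
  swap = solve 3 (λ a b d → a :* (b :* d) := b :* (a :* d)) refl

p*q≡0⇒p≡0 : ∀ p q → p * q ≡ 0ℚ → q ≢ 0ℚ → p ≡ 0ℚ
p*q≡0⇒p≡0 p q pq≡0 q≢0 = begin
  p                ≡⟨ sym (ℚP.*-identityʳ p) ⟩
  p * 1ℚ           ≡⟨ cong (p *_) (sym (ℚP.*-inverseʳ q)) ⟩
  p * (q * 1/ q)   ≡⟨ sym (ℚP.*-assoc p q (1/ q)) ⟩
  p * q * 1/ q     ≡⟨ cong (_* 1/ q) pq≡0 ⟩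
  0ℚ * 1/ q        ≡⟨ ℚP.*-zeroˡ (1/ q) ⟩
  0ℚ               ∎
  where instance _ = ℚ.≢-nonZero q≢0

Nontrivial : Vector ℚ n → Set
Nontrivial y = ∃[ i ] y i ≢ 0ℚ

Orthogonal : Vector ℚ n → (Fin r → Vector ℚ n) → Set
Orthogonal y vs = ∀ t → dot y (vs t) ≡ 0ℚ

Independent : (Fin r → Vector ℚ n) → Set
Independent vs = ∀ c → (∀ i → linComb c vs i ≡ 0ℚ) → ∀ t → c t ≡ 0ℚ

module PivotElimination (vs : Fin (suc m) → Vector ℚ (suc n))
                        (p : Fin (suc m)) (pivot : vs p zero ≢ 0ℚ) where
  private instance
    pivot-nonZero : ℚ.NonZero (vs p zero)
    pivot-nonZero = ℚ.≢-nonZero pivot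

  ratio : Fin (suc m) → ℚ
  ratio e = vs e zero * 1/ vs p zero

  reduced : Fin m → Vector ℚ n
  reduced e j = tail (vs (punchIn p e)) j - ratio (punchIn p e) * tail (vs p) j

  lift : Vector ℚ n → Vector ℚ (suc n)
  lift y = - (dot y (tail (vs p)) * 1/ vs p zero) ∷ y

  dot-lift : ∀ y e → dot (lift y) (vs e) ≡ dot y (tail (vs e)) - ratio e * dot y (tail (vs p))
  dot-lift y e = solve 4 (λ s i a t → (:- (s :* i)) :* a :+ t := t :- a :* i :* s) refl
    (dot y (tail (vs p))) (1/ vs p zero) (vs e zero) (dot y (tail (vs e)))
    where open +-*-Solver

  lift-orthogonal : ∀ y → Orthogonal y reduced → Orthogonal (lift y) vs
  lift-orthogonal y y⊥ e with p FinP.≟ e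
  ... | yes refl = begin
    dot (lift y) (vs p)        ≡⟨ dot-lift y p ⟩
    S - ratio p * S            ≡⟨ cong (λ k → S - k * S) (ℚP.*-inverseʳ (vs p zero)) ⟩
    S - 1ℚ * S                 ≡⟨ solve 1 (λ s → s :- con 1ℚ :* s := con 0ℚ) refl S ⟩
    0ℚ                         ∎
    where
    open +-*-Solver
    S = dot y (tail (vs p))
  ... | no p≢e = subst (λ e → dot (lift y) (vs e) ≡ 0ℚ) (FinP.punchIn-punchOut p≢e) (begin
    dot (lift y) (vs e′)                                       ≡⟨ dot-lift y e′ ⟩
    dot y (tail (vs e′)) - ratio e′ * dot y (tail (vs p))     ≡⟨ sym (dot-linear y _ _ (ratio e′)) ⟩
    dot y (reduced (punchOut p≢e))                             ≡⟨ y⊥ (punchOut p≢e) ⟩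
    0ℚ                                                         ∎)
    where e′ = punchIn p (punchOut p≢e)

nonzero-orthogonal : m ℕ.< n → (vs : Fin m → Vector ℚ n) → ∃[ y ] Nontrivial y × Orthogonal y vs
nonzero-orthogonal {zero}  {suc n} _ vs = (λ _ → 1ℚ) , (zero , λ ()) , λ ()
nonzero-orthogonal {suc m} {suc n} (s≤s m<n) vs with FinP.all? (λ e → vs e zero ℚP.≟ 0ℚ)
... | yes heads≡0 = (1ℚ ∷ λ _ → 0ℚ) , (zero , λ ()) , λ e →
  cong₂ _+_ (cong (1ℚ *_) (heads≡0 e)) (sumℚ-zero (λ j → ℚP.*-zeroˡ (vs e (suc j))))
... | no ¬heads≡0 with FinP.¬∀⟶∃¬ _ _ (λ e → vs e zero ℚP.≟ 0ℚ) ¬heads≡0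
... | p , pivot =
  let open PivotElimination vs p pivot
      (y , (j , yj≢0) , y⊥) = nonzero-orthogonal m<n reduced
  in lift y , (suc j , yj≢0) , lift-orthogonal y y⊥

independent⇒≤ : {vs : Fin r → Vector ℚ n} → Independent vs → r ℕ.≤ n
independent⇒≤ {r} {n} {vs} ind with r ℕ.≤? n
... | yes r≤n = r≤n
... | no r≰n =
  let (c , (t , ct≢0) , c⊥) = nonzero-orthogonal (ℕP.≰⇒> r≰n) (λ i t → vs t i)
  in ⊥-elim (ct≢0 (ind c c⊥ t))

independent-∷ : ∀ {y v} {vs : Fin r → Vector ℚ n} →
  Independent vs → Orthogonal y vs → dot y v ≢ 0ℚ → Independent (v ∷ vs)
independent-∷ {y = y} {v} {vs} ind y⊥ yv≢0 c comb≡0 = coeffs≡0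
  where
  head≡0 : c zero ≡ 0ℚ
  head≡0 = p*q≡0⇒p≡0 (c zero) (dot y v) (begin
    c zero * dot y v                                           ≡⟨ sym (ℚP.+-identityʳ _) ⟩
    c zero * dot y v + 0ℚ
      ≡⟨ cong (c zero * dot y v +_) (sym (dot-zeroʳ (c ∘ suc) y⊥)) ⟩
    dot c (λ t → dot y ((v ∷ vs) t))                           ≡⟨ sym (dot-linComb y c (v ∷ vs)) ⟩
    dot y (linComb c (v ∷ vs))                                 ≡⟨ dot-zeroʳ y comb≡0 ⟩
    0ℚ                                                         ∎) yv≢0
  tail≡0 : ∀ i → linComb (c ∘ suc) vs i ≡ 0ℚ
  tail≡0 i = begin
    linComb (c ∘ suc) vs i                      ≡⟨ sym (ℚP.+-identityˡ _) ⟩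
    0ℚ + linComb (c ∘ suc) vs i
      ≡⟨ cong (_+ linComb (c ∘ suc) vs i) (sym (trans (cong (_* v i) head≡0) (ℚP.*-zeroˡ (v i)))) ⟩
    c zero * v i + linComb (c ∘ suc) vs i       ≡⟨ comb≡0 i ⟩
    0ℚ                                          ∎
  coeffs≡0 : ∀ t → c t ≡ 0ℚ
  coeffs≡0 zero    = head≡0
  coeffs≡0 (suc t) = ind (c ∘ suc) tail≡0 t

independent-removeAt : {vs : Fin (suc r) → Vector ℚ n} → Independent vs → ∀ p → Independent (removeAt vs p)
independent-removeAt {vs = vs} ind p c comb≡0 q = begin
  c q                 ≡⟨ sym (insertAt-punchIn c p 0ℚ q) ⟩
  c′ (punchIn p q)    ≡⟨ ind c′ comb′≡0 (punchIn p q) ⟩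
  0ℚ                  ∎
  where
  c′ = insertAt c p 0ℚ
  comb′≡0 : ∀ i → linComb c′ vs i ≡ 0ℚ
  comb′≡0 i = begin
    linComb c′ vs i                                               ≡⟨ sumℚ-remove p (λ t → c′ t * vs t i) ⟩
    c′ p * vs p i + sumℚ (λ q → c′ (punchIn p q) * vs (punchIn p q) i)
      ≡⟨ cong₂ _+_ (trans (cong (_* vs p i) (insertAt-lookup c p 0ℚ)) (ℚP.*-zeroˡ (vs p i)))
                   (sumℚ-cong (λ q → cong (_* vs (punchIn p q) i) (insertAt-punchIn c p 0ℚ q))) ⟩
    0ℚ + linComb c (removeAt vs p) i                              ≡⟨ ℚP.+-identityˡ _ ⟩
    linComb c (removeAt vs p) i                                   ≡⟨ comb≡0 i ⟩
    0ℚ                                                            ∎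

unit : Fin (suc n) → Vector ℚ (suc n)
unit i = insertAt (λ _ → 0ℚ) i 1ℚ

dot-unit : (y : Vector ℚ (suc n)) (i : Fin (suc n)) → dot y (unit i) ≡ y i
dot-unit y i = begin
  dot y (unit i)                                              ≡⟨ sumℚ-remove i (λ j → y j * unit i j) ⟩
  y i * unit i i + sumℚ (λ q → y (punchIn i q) * unit i (punchIn i q))
    ≡⟨ cong₂ _+_ (cong (y i *_) (insertAt-lookup _ i 1ℚ))
                 (dot-zeroʳ (removeAt y i) (insertAt-punchIn (λ _ → 0ℚ) i 1ℚ)) ⟩
  y i * 1ℚ + 0ℚ                                               ≡⟨ trans (ℚP.+-identityʳ _) (ℚP.*-identityʳ (y i)) ⟩
  y i                                                         ∎

orthogonal-to-basis⇒zero : ∀ {y} {vs : Fin n → Vector ℚ n} → Independent vs → Orthogonal y vs → ∀ i → y i ≡ 0ℚ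
orthogonal-to-basis⇒zero {suc n} {y} {vs} ind y⊥ i with y i ℚP.≟ 0ℚ
... | yes yi≡0 = yi≡0
... | no yi≢0  =
  ⊥-elim (ℕP.1+n≰n (independent⇒≤ {vs = unit i ∷ vs} (independent-∷ {y = y} {unit i} {vs} ind y⊥ yei≢0)))
  where
  yei≢0 : dot y (unit i) ≢ 0ℚ
  yei≢0 = yi≢0 ∘ trans (sym (dot-unit y i))

ι-mkℚ : ∀ z → ι z ≡ ℚ.mkℚ z 0 (Coprime.sym (Coprime.1-coprimeTo ℤ.∣ z ∣))
ι-mkℚ (ℤ.+ n)    = ℚP.normalize-coprime (Coprime.sym (Coprime.1-coprimeTo n))
ι-mkℚ ℤ.-[1+ n ] = cong -_ (ℚP.normalize-coprime (Coprime.sym (Coprime.1-coprimeTo (suc n))))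

ι-+ : ∀ a b → ι (a ℤ.+ b) ≡ ι a + ι b
ι-+ a b = sym (trans (cong₂ _+_ (ι-mkℚ a) (ι-mkℚ b))
  (cong₂ (λ x y → (x ℤ.+ y) ℚ./ 1) (ℤP.*-identityʳ a) (ℤP.*-identityʳ b)))

ι-* : ∀ a b → ι (a ℤ.* b) ≡ ι a * ι b
ι-* a b = sym (cong₂ _*_ (ι-mkℚ a) (ι-mkℚ b))

ι-sumℤ : (f : Fin n → ℤ) → ι (sumℤ f) ≡ sumℚ (ι ∘ f)
ι-sumℤ {zero}  f = refl
ι-sumℤ {suc n} f = trans (ι-+ (f zero) (sumℤ (f ∘ suc))) (cong (ι (f zero) +_) (ι-sumℤ (f ∘ suc)))

ι-neg : ∀ a → ι (ℤ.- a) ≡ - ι a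
ι-neg (ℤ.+ zero)  = refl
ι-neg ℤ.+[1+ n ]  = refl
ι-neg ℤ.-[1+ n ]  = trans (ι-mkℚ (ℤ.+ suc n)) (cong -_ (sym (ι-mkℚ ℤ.-[1+ n ])))

ι-- : ∀ a b → ι (a ℤ.- b) ≡ ι a - ι b
ι-- a b = trans (ι-+ a (ℤ.- b)) (cong (ι a +_) (ι-neg b))

ι-mono-< : ∀ {a b} → a ℤ.< b → ι a ℚ.< ι b
ι-mono-< {a} {b} a<b rewrite ι-mkℚ a | ι-mkℚ b =
  ℚ.*<* (subst₂ ℤ._<_ (sym (ℤP.*-identityʳ a)) (sym (ℤP.*-identityʳ b)) a<b)

0<ι-suc : ∀ n → 0ℚ ℚ.< ι (ℤ.+ suc n)
0<ι-suc n = ι-mono-< {ℤ.+ 0} {ℤ.+ suc n} (ℤ.+<+ (s≤s z≤n))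

-- ColsIndependent A f is, definitionally, Independent (column A ∘ f).
column : Matrix l k → Fin k → Vector ℚ l
column A j i = ι (A i j)

rowComb : Matrix l k → Vector ℚ l → Vector ℚ k
rowComb A y j = dot y (column A j)

-- e need not be injective: only its length ∣ W ∣ matters.
enumerate : (W : Subset k) → Σ[ e ∈ (Fin ∣ W ∣ → Fin k) ] (∀ j → j ∈ W → ∃[ u ] e u ≡ j)
enumerate []            = (λ ()) , λ _ ()
enumerate (outside ∷ᵥ W) with enumerate W
... | e , covers = suc ∘ e , λ { (suc j) (there j∈W) → let (u , eu≡j) = covers j j∈W in u , cong suc eu≡j }
enumerate (inside ∷ᵥ W) with enumerate W
... | e , covers = zero ∷ suc ∘ e , λ
  { zero    _           → zero , refl
  ; (suc j) (there j∈W) → let (u , eu≡j) = covers j j∈W in suc u , cong suc eu≡j }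

module _ (A : Matrix l k) where

  basis : ∀ {S} → IsColRank A S r → Fin r → Fin k
  basis ((f , _) , _) = f

  extend-basis : ∀ {f : Fin r → Fin k} {y j} → Injective _≡_ _≡_ f → ColsIndependent A f →
    (∀ t → rowComb A y (f t) ≡ 0ℚ) → rowComb A y j ≢ 0ℚ →
    Injective _≡_ _≡_ (j ∷ f) × ColsIndependent A (j ∷ f)
  extend-basis {f = f} {y} {j} f-inj f-ind y⊥f yj≢0 =
    j∷f-inj , independent-∷ {y = y} {column A j} {column A ∘ f} f-ind y⊥f yj≢0
    where
    j≢f : ∀ t → j ≢ f t
    j≢f t j≡ft = yj≢0 (trans (cong (rowComb A y) j≡ft) (y⊥f t))
    j∷f-inj : Injective _≡_ _≡_ (j ∷ f)
    j∷f-inj {zero}  {zero}  _  = refl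
    j∷f-inj {zero}  {suc t} eq = ⊥-elim (j≢f t eq)
    j∷f-inj {suc t} {zero}  eq = ⊥-elim (j≢f t (sym eq))
    j∷f-inj {suc t} {suc u} eq = cong suc (f-inj eq)

  orthogonal-to-basis⇒orthogonal : ∀ {S y} (rank : IsColRank A S r) →
    (∀ t → rowComb A y (basis rank t) ≡ 0ℚ) → ∀ j → j ∈ S → rowComb A y j ≡ 0ℚ
  orthogonal-to-basis⇒orthogonal {S = S} {y} ((f , f-inj , f∈S , f-ind) , maximal) y⊥f j j∈S
    with rowComb A y j ℚP.≟ 0ℚ
  ... | yes yj≡0 = yj≡0
  ... | no yj≢0 with extend-basis {f = f} {y} {j} f-inj f-ind y⊥f yj≢0
  ...   | j∷f-inj , j∷f-ind = ⊥-elim (maximal (j ∷ f) j∷f-inj j∷f∈S j∷f-ind)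
    where
    j∷f∈S : ∀ t → (j ∷ f) t ∈ S
    j∷f∈S zero    = j∈S
    j∷f∈S (suc t) = f∈S t

  irredundant⇒no-single-support : Irredundant A → ∀ y w →
    (∀ j → j ≢ w → rowComb A y j ≡ 0ℚ) → rowComb A y w ≡ 0ℚ
  irredundant⇒no-single-support (x , x≥1 , _ , Ax≡0) y w off-w =
    p*q≡0⇒p≡0 (rowComb A y w) (X w) (begin
      rowComb A y w * X w             ≡⟨ ℚP.*-comm _ (X w) ⟩
      X w * rowComb A y w
        ≡⟨ sumℚ-single w _ (λ j j≢w → trans (cong (X j *_) (off-w j j≢w)) (ℚP.*-zeroʳ (X j))) ⟨
      dot X (rowComb A y)             ≡⟨ dot-linComb y X (column A) ⟨
      dot y (linComb X (column A))    ≡⟨ dot-zeroʳ y AX≡0 ⟩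
      0ℚ                              ∎) (Xw≢0 (x w) (x≥1 w))
    where
    X : Vector ℚ k
    X j = ι (ℤ.+ x j)
    Xw≢0 : ∀ n → 1 ℕ.≤ n → ι (ℤ.+ n) ≢ 0ℚ
    Xw≢0 (suc n) _ = ℚP.<⇒≢ (0<ι-suc n) ∘ sym
    AX≡0 : ∀ i → linComb X (column A) i ≡ 0ℚ
    AX≡0 i = begin
      sumℚ (λ j → X j * ι (A i j))
        ≡⟨ sumℚ-cong (λ j → trans (ℚP.*-comm (X j) _) (sym (ι-* (A i j) (ℤ.+ x j)))) ⟩
      sumℚ (λ j → ι (A i j ℤ.* ℤ.+ x j))     ≡⟨ ι-sumℤ (λ j → A i j ℤ.* ℤ.+ x j) ⟨
      ι (sumℤ (λ j → A i j ℤ.* ℤ.+ x j))     ≡⟨ cong ι (Ax≡0 i) ⟩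
      0ℚ                                     ∎

  module _ (irredundant : Irredundant A) (star : Star A)
           {h : Fin l → Fin k} (h-ind : ColsIndependent A h) where

    support-within-two⇒⊥ : ∀ {y} → Nontrivial y → ∀ a b →
      ¬ (∀ j → j ≢ a → j ≢ b → rowComb A y j ≡ 0ℚ)
    support-within-two⇒⊥ {y} (i , yi≢0) a b off-ab with rowComb A y b ℚP.≟ 0ℚ
    ... | yes yb≡0 = yi≢0 (orthogonal-to-basis⇒zero {y = y} {vs = column A ∘ h} h-ind (everywhere ∘ h) i)
      where
      off-a : ∀ j → j ≢ a → rowComb A y j ≡ 0ℚ
      off-a j j≢a with j FinP.≟ b
      ... | yes refl = yb≡0
      ... | no j≢b   = off-ab j j≢a j≢b
      everywhere : ∀ j → rowComb A y j ≡ 0ℚ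
      everywhere j with j FinP.≟ a
      ... | yes refl = irredundant⇒no-single-support irredundant y a off-a
      ... | no j≢a   = off-a j j≢a
    ... | no yb≢0 with rowComb A y a ℚP.≟ 0ℚ | a FinP.≟ b
    ... | yes ya≡0 | _ = yb≢0 (irredundant⇒no-single-support irredundant y b off-b)
      where
      off-b : ∀ j → j ≢ b → rowComb A y j ≡ 0ℚ
      off-b j j≢b with j FinP.≟ a
      ... | yes refl = ya≡0
      ... | no j≢a   = off-ab j j≢a j≢b
    ... | no ya≢0 | yes refl = ya≢0 (irredundant⇒no-single-support irredundant y a (λ j j≢a → off-ab j j≢a j≢a))
    ... | no ya≢0 | no a≢b   = star y (a , b , a≢b , ya≢0 , yb≢0 , off-ab)

    small-rank⇒⊥ : ∀ {W r} (rank : IsColRank A (∁ W) r) a b {n} (e : Fin n → Fin k) →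
      (∀ j → j ∈ W → j ≢ a → j ≢ b → ∃[ u ] e u ≡ j) → n ℕ.+ r ℕ.< l → ⊥
    small-rank⇒⊥ {W} {r} rank a b {n} e covers n+r<l
      with nonzero-orthogonal n+r<l (column A ∘ (e ++ basis rank))
    ... | y , y≢0 , y⊥ = support-within-two⇒⊥ y≢0 a b off-ab
      where
      on-e : ∀ u → rowComb A y (e u) ≡ 0ℚ
      on-e u = subst (λ j → rowComb A y j ≡ 0ℚ) (lookup-++ˡ e (basis rank) u) (y⊥ (u ↑ˡ r))
      on-basis : ∀ t → rowComb A y (basis rank t) ≡ 0ℚ
      on-basis t = subst (λ j → rowComb A y j ≡ 0ℚ) (lookup-++ʳ e (basis rank) t) (y⊥ (n ↑ʳ t))
      off-ab : ∀ j → j ≢ a → j ≢ b → rowComb A y j ≡ 0ℚ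
      off-ab j j≢a j≢b with j ∈? W
      ... | yes j∈W = let (u , eu≡j) = covers j j∈W j≢a j≢b in subst (λ j → rowComb A y j ≡ 0ℚ) eu≡j (on-e u)
      ... | no j∉W  = orthogonal-to-basis⇒orthogonal {y = y} rank on-basis j (x∉p⇒x∈∁p j∉W)

    rank-deficit-covered : ∀ {W r} → IsColRank A (∁ W) r → ∀ {n} (e : Fin n → Fin k) →
      (∀ j → j ∈ W → ∃[ u ] e u ≡ j) → 2 ℕ.≤ n → l ℕ.+ 2 ℕ.≤ n ℕ.+ r
    rank-deficit-covered rank {suc zero} e covers (s≤s ())
    rank-deficit-covered {W} {r} rank {suc (suc n)} e covers _ with l ℕ.+ 2 ℕ.≤? suc (suc n) ℕ.+ r
    ... | yes deficit = deficit
    ... | no ¬deficit = ⊥-elim (small-rank⇒⊥ rank (e zero) (e (suc zero)) (λ u → e (suc (suc u))) covers′ n+r<l)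
      where
      n+r<l : n ℕ.+ r ℕ.< l
      n+r<l = ℕP.+-cancelˡ-≤ 2 _ _ (subst (suc (suc (suc n)) ℕ.+ r ℕ.≤_) (ℕP.+-comm l 2) (ℕP.≰⇒> ¬deficit))
      covers′ : ∀ j → j ∈ W → j ≢ e zero → j ≢ e (suc zero) → ∃[ u ] e (suc (suc u)) ≡ j
      covers′ j j∈W j≢e₀ j≢e₁ with covers j j∈W
      ... | zero , e₀≡j          = ⊥-elim (j≢e₀ (sym e₀≡j))
      ... | suc zero , e₁≡j      = ⊥-elim (j≢e₁ (sym e₁≡j))
      ... | suc (suc u) , eu≡j   = u , eu≡j

    rank-deficit : ∀ {W r} → IsColRank A (∁ W) r → 2 ℕ.≤ ∣ W ∣ → l ℕ.+ 2 ℕ.≤ ∣ W ∣ ℕ.+ r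
    rank-deficit {W} rank = rank-deficit-covered rank (proj₁ (enumerate W)) (proj₂ (enumerate W))

avoiding-basis : (A : Matrix (suc l) k) → Irredundant A → Star A → IsColRank A ⊤ (suc l) → ∀ w →
  Σ[ g ∈ (Fin (suc l) → Fin k) ] Injective _≡_ _≡_ g × (∀ t → g t ≢ w) × ColsIndependent A g
avoiding-basis A irredundant star ((h , h-inj , _ , h-ind) , _) w with FinP.any? (λ p → h p FinP.≟ w)
... | no w∉h = h , h-inj , (λ t ht≡w → w∉h (t , ht≡w)) , h-ind
-- w = h p: some y ≠ 0 orthogonal to the other columns of h has (yA)_j ≠ 0 at a column
-- j ≠ w, and j can take the place of w.
... | yes (p , hp≡w) with nonzero-orthogonal ℕP.≤-refl (column A ∘ removeAt h p)
... | y , y≢0 , y⊥ with FinP.¬∀⟶∃¬ _ _ (λ j → (j FinP.≟ w) ⊎-dec (rowComb A y j ℚP.≟ 0ℚ)) not-supported-on-w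
  where
  not-supported-on-w : ¬ (∀ j → j ≡ w ⊎ rowComb A y j ≡ 0ℚ)
  not-supported-on-w on-w = support-within-two⇒⊥ A irredundant star {h} h-ind y≢0 w w off-w
    where
    off-w : ∀ j → j ≢ w → j ≢ w → rowComb A y j ≡ 0ℚ
    off-w j j≢w _ with on-w j
    ... | inj₁ j≡w  = ⊥-elim (j≢w j≡w)
    ... | inj₂ yj≡0 = yj≡0
... | j , ¬[j≡w⊎yj≡0]
  with extend-basis A {f = removeAt h p} {y} {j} (FinP.punchIn-injective p _ _ ∘ h-inj)
         (independent-removeAt {vs = column A ∘ h} h-ind p) y⊥ (¬[j≡w⊎yj≡0] ∘ inj₂)
... | j∷g-inj , j∷g-ind = j ∷ removeAt h p , j∷g-inj , avoids , j∷g-ind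
  where
  avoids : ∀ t → (j ∷ removeAt h p) t ≢ w
  avoids zero    = ¬[j≡w⊎yj≡0] ∘ inj₁
  avoids (suc t) ht≡w = FinP.punchInᵢ≢i p t (h-inj (trans ht≡w (sym hp≡w)))

covered-by-one : ∀ {W : Subset k} {n} (e : Fin n → Fin k) → (∀ j → j ∈ W → ∃[ u ] e u ≡ j) →
  n ≡ 1 → ∃[ w ] ∀ j → j ∈ W → j ≡ w
covered-by-one {W = W} e covers refl = e zero , e₀-only
  where
  e₀-only : ∀ j → j ∈ W → j ≡ e zero
  e₀-only j j∈W with covers j j∈W
  ... | zero , e₀≡j = sym e₀≡j

rank-without-one-column : (A : Matrix (suc l) k) → Irredundant A → Star A → IsColRank A ⊤ (suc l) →
  ∀ W → ∣ W ∣ ≡ 1 → IsColRank A (∁ W) (suc l)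
rank-without-one-column A irredundant star rank W |W|≡1
  with covered-by-one (proj₁ (enumerate W)) (proj₂ (enumerate W)) |W|≡1
... | w , W⊆w with avoiding-basis A irredundant star rank w
... | g , g-inj , g≢w , g-ind =
    (g , g-inj , (λ t → x∉p⇒x∈∁p (g≢w t ∘ W⊆w (g t))) , g-ind)
  , λ g′ g′-inj _ → proj₂ rank g′ g′-inj (λ _ → ∈⊤)

rank-∁⊤ : (A : Matrix l k) → IsColRank A (∁ ⊤) 0
rank-∁⊤ A = ((λ ()) , (λ { {()} }) , (λ ()) , (λ _ _ ())) , λ g _ g∈∅ _ → x∈∁p⇒x∉p (g∈∅ zero) ∈⊤

columns≥rank+2 : (A : Matrix (suc l) k) → Irredundant A → Star A → IsColRank A ⊤ (suc l) →
  suc l ℕ.+ 2 ℕ.≤ k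
columns≥rank+2 {k = zero} A _ _ ((h , _) , _) with h zero
... | ()
columns≥rank+2 {k = suc zero} A irredundant star ((h , _ , _ , h-ind) , _) =
  ⊥-elim (support-within-two⇒⊥ A irredundant star {h} h-ind {λ _ → 1ℚ} (zero , λ ()) zero zero
    λ { zero 0≢0 _ → ⊥-elim (0≢0 refl) })
columns≥rank+2 {l} {suc (suc k)} A irredundant star ((h , _ , _ , h-ind) , _) =
  subst (suc l ℕ.+ 2 ℕ.≤_) (trans (ℕP.+-identityʳ _) (∣⊤∣≡n (suc (suc k))))
    (rank-deficit A irredundant star {h} h-ind (rank-∁⊤ A)
      (subst (2 ℕ.≤_) (sym (∣⊤∣≡n (suc (suc k)))) (s≤s (s≤s z≤n))))

p÷₀q*q≡p : ∀ p {q} → 0ℚ ℚ.< q → (p ÷₀ q) * q ≡ p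
p÷₀q*q≡p p {q} 0<q with q ℚP.≟ 0ℚ
... | yes q≡0 = ⊥-elim (ℚP.<⇒≢ 0<q (sym q≡0))
... | no q≢0  = trans (ℚP.*-assoc p (1/ q) q) (trans (cong (p *_) (ℚP.*-inverseˡ q)) (ℚP.*-identityʳ p))
  where instance _ = ℚ.≢-nonZero q≢0

1<p÷₀q : ∀ {p q} → 0ℚ ℚ.< q → q ℚ.< p → 1ℚ ℚ.< p ÷₀ q
1<p÷₀q {p} {q} 0<q q<p = ℚP.*-cancelʳ-<-nonNeg q {{ℚP.pos⇒nonNeg q {{ℚ.positive 0<q}}}}
  (subst₂ ℚ._<_ (sym (ℚP.*-identityˡ q)) (sym (p÷₀q*q≡p p 0<q)) q<p)

p÷₀q≤r⇒p÷₀r≤q : ∀ {p q r} → 0ℚ ℚ.< q → 0ℚ ℚ.< r → p ÷₀ q ℚ.≤ r → p ÷₀ r ℚ.≤ q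
p÷₀q≤r⇒p÷₀r≤q {p} {q} {r} 0<q 0<r p÷q≤r = ℚP.*-cancelʳ-≤-pos r {{ℚ.positive 0<r}}
  (subst₂ ℚ._≤_ (sym (p÷₀q*q≡p p 0<r)) (ℚP.*-comm r q)
    (subst (ℚ._≤ r * q) (p÷₀q*q≡p p 0<q) (ℚP.*-monoʳ-≤-nonNeg q {{ℚP.pos⇒nonNeg q {{ℚ.positive 0<q}}}} p÷q≤r)))

denominator≡ : ∀ s r L t → L ℕ.+ 2 ℕ.+ t ≡ s ℕ.+ r → ℤ.+ s ℤ.- ℤ.+ 1 ℤ.+ ℤ.+ r ℤ.- ℤ.+ L ≡ ℤ.+ suc t
denominator≡ s r L t L+2+t≡s+r = begin
  ℤ.+ s ℤ.- ℤ.+ 1 ℤ.+ ℤ.+ r ℤ.- ℤ.+ L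
    ≡⟨ solve 4 (λ s r L o → s :- o :+ r :- L := (s :+ r) :- L :- o) refl (ℤ.+ s) (ℤ.+ r) (ℤ.+ L) (ℤ.+ 1) ⟩
  ℤ.+ s ℤ.+ ℤ.+ r ℤ.- ℤ.+ L ℤ.- ℤ.+ 1
    ≡⟨ cong (λ z → z ℤ.- ℤ.+ L ℤ.- ℤ.+ 1) (trans (sym (ℤP.pos-+ s r)) (cong ℤ.+_ (sym L+2+t≡s+r))) ⟩
  ℤ.+ (L ℕ.+ 2 ℕ.+ t) ℤ.- ℤ.+ L ℤ.- ℤ.+ 1
    ≡⟨ cong (λ z → z ℤ.- ℤ.+ L ℤ.- ℤ.+ 1) (trans (ℤP.pos-+ (L ℕ.+ 2) t) (cong (ℤ._+ ℤ.+ t) (ℤP.pos-+ L 2))) ⟩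
  ℤ.+ L ℤ.+ ℤ.+ 2 ℤ.+ ℤ.+ t ℤ.- ℤ.+ L ℤ.- ℤ.+ 1
    ≡⟨ solve 2 (λ L t → L :+ con (ℤ.+ 2) :+ t :- L :- con (ℤ.+ 1) := con (ℤ.+ 1) :+ t) refl (ℤ.+ L) (ℤ.+ t) ⟩
  ℤ.+ suc t ∎
  where open ZSolver.+-*-Solver

0<denominator : ∀ {s r L} → L ℕ.+ 2 ℕ.≤ s ℕ.+ r → 0ℚ ℚ.< ι (ℤ.+ s ℤ.- ℤ.+ 1 ℤ.+ ℤ.+ r ℤ.- ℤ.+ L)
0<denominator {s} {r} {L} deficit =
  let (t , L+2+t≡s+r) = ℕP.m≤n⇒∃[o]m+o≡n deficit
  in subst (λ z → 0ℚ ℚ.< ι z) (sym (denominator≡ s r L t L+2+t≡s+r)) (0<ι-suc t)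

1<density : ∀ {w L} → suc L ℕ.+ 2 ℕ.≤ w → 1ℚ ℚ.< density w 0 (suc L)
1<density {w} {L} L+3≤w =
  1<p÷₀q {ι (ℤ.+ w ℤ.- ℤ.+ 1)}
    (0<denominator {w} {0} (subst (suc L ℕ.+ 2 ℕ.≤_) (sym (ℕP.+-identityʳ w)) L+3≤w)) (ι-mono-< D<N)
  where
  D = ℤ.+ w ℤ.- ℤ.+ 1 ℤ.+ ℤ.+ 0 ℤ.- ℤ.+ suc L
  N≡D+L : ℤ.+ w ℤ.- ℤ.+ 1 ≡ D ℤ.+ ℤ.+ suc L
  N≡D+L = solve 2 (λ w L → w :- con (ℤ.+ 1) := w :- con (ℤ.+ 1) :+ con (ℤ.+ 0) :- L :+ L) refl (ℤ.+ w) (ℤ.+ suc L)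
    where open ZSolver.+-*-Solver
  D<N : D ℤ.< ℤ.+ w ℤ.- ℤ.+ 1
  D<N = subst₂ ℤ._<_ (ℤP.+-identityʳ D) (sym N≡D+L) (ℤP.+-monoʳ-< D (ℤ.+<+ (s≤s z≤n)))

inverse-density-bound : ∀ {s r L q} → L ℕ.+ 2 ℕ.≤ s ℕ.+ r → 0ℚ ℚ.< q → density s r L ℚ.≤ q →
  - ι (ℤ.+ s) - ι (ℤ.+ r) ℚ.≤ - ι (ℤ.+ L) - ι (ℤ.+ 1) - (ι (ℤ.+ s ℤ.- ℤ.+ 1) ÷₀ q)
inverse-density-bound {s} {r} {L} {q} deficit 0<q density≤q =
  subst (ℚ._≤ _) -L-1-D≡-s-r
    (ℚP.+-monoʳ-≤ (- ι (ℤ.+ L) - ι (ℤ.+ 1))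
      (ℚP.neg-antimono-≤ (p÷₀q≤r⇒p÷₀r≤q (0<denominator {s} {r} {L} deficit) 0<q density≤q)))
  where
  S = ι (ℤ.+ s)
  R = ι (ℤ.+ r)
  Lq = ι (ℤ.+ L)
  O = ι (ℤ.+ 1)
  D≡ : ι (ℤ.+ s ℤ.- ℤ.+ 1 ℤ.+ ℤ.+ r ℤ.- ℤ.+ L) ≡ S - O + R - Lq
  D≡ = trans (ι-- (ℤ.+ s ℤ.- ℤ.+ 1 ℤ.+ ℤ.+ r) (ℤ.+ L))
    (cong (_- Lq) (trans (ι-+ (ℤ.+ s ℤ.- ℤ.+ 1) (ℤ.+ r)) (cong (_+ R) (ι-- (ℤ.+ s) (ℤ.+ 1)))))
  -L-1-D≡-s-r : - Lq - O + - ι (ℤ.+ s ℤ.- ℤ.+ 1 ℤ.+ ℤ.+ r ℤ.- ℤ.+ L) ≡ - S - R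
  -L-1-D≡-s-r = trans (cong (λ d → - Lq - O + - d) D≡)
    (solve 4 (λ S R L O → :- L :- O :+ (:- (S :- O :+ R :- L)) := :- S :- R) refl S R Lq O)
    where open +-*-Solver

deficit-ℤ : ∀ {l r w} → l ℕ.+ 2 ℕ.≤ w ℕ.+ r → ℤ.+ l ℤ.- ℤ.+ r ℤ.+ ℤ.+ 2 ℤ.≤ ℤ.+ w
deficit-ℤ {l} {r} {w} deficit = subst₂ ℤ._≤_ lhs≡ rhs≡ (ℤP.+-monoˡ-≤ (ℤ.- ℤ.+ r) (ℤ.+≤+ deficit))
  where
  open ZSolver.+-*-Solver
  lhs≡ : ℤ.+ (l ℕ.+ 2) ℤ.- ℤ.+ r ≡ ℤ.+ l ℤ.- ℤ.+ r ℤ.+ ℤ.+ 2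
  lhs≡ = trans (cong (ℤ._- ℤ.+ r) (ℤP.pos-+ l 2))
    (solve 3 (λ a b c → a :+ c :- b := a :- b :+ c) refl (ℤ.+ l) (ℤ.+ r) (ℤ.+ 2))
  rhs≡ : ℤ.+ (w ℕ.+ r) ℤ.- ℤ.+ r ≡ ℤ.+ w
  rhs≡ = trans (cong (ℤ._- ℤ.+ r) (ℤP.pos-+ w r))
    (solve 2 (λ a b → a :+ b :- b := a) refl (ℤ.+ w) (ℤ.+ r))

1<m : (A : Matrix (suc l) k) → IsColRank A ⊤ (suc l) → suc l ℕ.+ 2 ℕ.≤ k → ∀ q → IsM A q → 1ℚ ℚ.< q
1<m {l} {k} A rank l+3≤k q (_ , maximal) =
  ℚP.<-≤-trans (1<density l+3≤∣⊤∣)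
    (maximal ⊤ (ℕP.≤-trans (ℕP.m≤n+m 2 (suc l)) l+3≤∣⊤∣) 0 (suc l) (rank-∁⊤ A) rank)
  where
  l+3≤∣⊤∣ : suc l ℕ.+ 2 ℕ.≤ ∣ ⊤ {k} ∣
  l+3≤∣⊤∣ = subst (suc l ℕ.+ 2 ℕ.≤_) (sym (∣⊤∣≡n k)) l+3≤k

proposition4p3 : ∀ {l k} (A : Matrix l k) → 1 ℕ.≤ l →
    Irredundant A → IsColRank A ⊤ l → Star A →
    (∀ (W : Subset k) → ∣ W ∣ ≡ 1 → IsColRank A (∁ W) l)
    × (∀ (W : Subset k) → 2 ℕ.≤ ∣ W ∣ → ∀ r → IsColRank A (∁ W) r →
         ℤ.+ l ℤ.- ℤ.+ r ℤ.+ ℤ.+ 2 ℤ.≤ ℤ.+ ∣ W ∣)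
    × (∀ q → IsM A q → ∀ (W : Subset k) → 2 ℕ.≤ ∣ W ∣ → ∀ r → IsColRank A (∁ W) r →
         ℚ.- ι (ℤ.+ ∣ W ∣) ℚ.- ι (ℤ.+ r)
           ℚ.≤ ℚ.- ι (ℤ.+ l) ℚ.- ι (ℤ.+ 1) ℚ.- (ι (ℤ.+ ∣ W ∣ ℤ.- ℤ.+ 1) ÷₀ q))
    × (l ℕ.+ 2 ℕ.≤ k)
    × (∀ q → IsM A q → ι (ℤ.+ 1) ℚ.< q)
proposition4p3 {suc l} A _ irredundant rank@((h , _ , _ , h-ind) , _) star =
    rank-without-one-column A irredundant star rank
  , (λ W 2≤∣W∣ r rank-W → deficit-ℤ (deficit rank-W 2≤∣W∣))
  , (λ q isM W 2≤∣W∣ r rank-W → inverse-density-bound {∣ W ∣} {r} (deficit rank-W 2≤∣W∣)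
       (ℚP.<-trans (ℚP.positive⁻¹ 1ℚ) (m>1 q isM)) (proj₂ isM W 2≤∣W∣ r (suc l) rank-W rank))
  , k≥l+2
  , m>1
  where
  deficit = rank-deficit A irredundant star {h} h-ind
  k≥l+2 = columns≥rank+2 A irredundant star rank
  m>1 = 1<m A rank k≥l+2
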